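{- Let $X$ be a finite quandle, $n$ a positive integer, $s=(x_1,\dots,x_n)\in X^n$, and $1\le\alpha<\beta\le n$ with $x_\alpha=x_\beta$. Then the image in $S_n$ of the stabilizer of $s$ in $B_n$ contains the transposition $(\alpha\ \beta)$.
   Context: A quandle is a set with operation $(x,y)\mapsto x^y$ such that each $x\mapsto x^y$ is bijective, $(z^x)^y=(z^y)^{x^y}$, and $x^x=x$. $B_n$ acts on $X^n$ on the right by $(\dots,c_i,c_{i+1},\dots)^{\sigma_i}=(\dots,c_{i+1},c_i^{c_{i+1}},\dots)$; $B_n\to S_n$ sends $\sigma_i\mapsto(i\ i+1)$. -}

module Defs where

open import Data.Nat using (ℕ; zero; suc)
open import Data.Fin using (Fin; zero; suc; inject₁; _≟_)
open import Data.Bool using (Bool; true; false)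
open import Data.Empty using (⊥)
open import Data.Product using (Σ; _×_; _,_; proj₁; proj₂)
open import Data.List using (List; []; _∷_)
open import Function using (_∘_; id)
open import Function.Bundles using (_↔_)
open import Function.Definitions using (Bijective)
open import Relation.Binary.PropositionalEquality using (_≡_)
open import Relation.Nullary using (yes; no)

record Quandle : Set₁ where
  field
    Carrier : Set
    _▷_     : Carrier → Carrier → Carrier
    bij     : ∀ y → Bijective {A = Carrier} {B = Carrier} _≡_ _≡_ (λ x → x ▷ y)
    selfdist : ∀ x y z → (z ▷ x) ▷ y ≡ (z ▷ y) ▷ (x ▷ y)
    idem    : ∀ x → x ▷ x ≡ x

  _◁_ : Carrier → Carrier → Carrier
  b ◁ y = proj₁ (proj₂ (bij y) b)

IsFinite : Set → Set
IsFinite A = Σ ℕ λ k → A ↔ Fin k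

-- Letters of braid words in B_n: (sign , i) stands for σ_i (true) or σ_i⁻¹ (false),
-- where i : Fin m indexes σ_{i+1} when n = suc m (0-indexed: swaps positions i, i+1).
Letter : ℕ → Set
Letter zero    = ⊥
Letter (suc m) = Bool × Fin m

BraidWord : ℕ → Set
BraidWord n = List (Letter n)

lpos rpos : ∀ {n} → Letter n → Fin n
lpos {suc m} (_ , i) = inject₁ i
rpos {suc m} (_ , i) = suc i

Tuple : Set → ℕ → Set
Tuple X n = Fin n → X

module Action (Q : Quandle) where
  open Quandle Q

  actLetter : ∀ {n} → Letter n → Tuple Carrier n → Tuple Carrier n
  actLetter {suc m} (true , i) t k with k ≟ inject₁ i | k ≟ suc i
  ... | yes _ | _     = t (suc i)
  ... | no _  | yes _ = t (inject₁ i) ▷ t (suc i)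
  ... | no _  | no _  = t k
  actLetter {suc m} (false , i) t k with k ≟ inject₁ i | k ≟ suc i
  ... | yes _ | _     = t (suc i) ◁ t (inject₁ i)
  ... | no _  | yes _ = t (inject₁ i)
  ... | no _  | no _  = t k

  -- right action of a braid word: first letter acts first
  act : ∀ {n} → BraidWord n → Tuple Carrier n → Tuple Carrier n
  act []      t = t
  act (l ∷ w) t = act w (actLetter l t)

swap : ∀ {n} → Fin n → Fin n → Fin n → Fin n
swap a b k with k ≟ a | k ≟ b
... | yes _ | _     = b
... | no _  | yes _ = a
... | no _  | no _  = k

perm : ∀ {n} → BraidWord n → Fin n → Fin n
perm []      = id
perm (l ∷ w) = perm w ∘ swap (lpos l) (rpos l)

-- If x_α = x_{α+1}, the generator σ_α fixes s because x ▷ x = x, and its image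
-- is (α α+1).  For β > α + 1, let t = s·σ_{β-1}: then t_α = x_α and t_{β-1} = x_β,
-- so by induction on β − α some braid w fixes t and maps to (α β-1).  The
-- conjugate σ_{β-1} w σ_{β-1}⁻¹ then fixes s and maps to
-- (β-1 β)(α β-1)(β-1 β) = (α β).
module Submission where

open import Defs
open import Data.Nat using (ℕ; _≤_; zero; suc; _+_; _∸_; s≤s⁻¹)
open import Data.Nat.Properties using (m≢1+n+m; m∸n+n≡m)
import Data.Nat.Properties as ℕ
open import Data.Fin using (Fin; _<_; zero; suc; inject₁; toℕ; _≟_)
open import Data.Fin.Properties using (toℕ-injective; toℕ-inject₁; suc-injective)
open import Data.Product using (Σ; _×_; _,_; proj₁; proj₂)
open import Data.Bool using (true; false)
open import Data.List using ([]; _∷_; _++_)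
open import Data.Empty using (⊥-elim)
open import Relation.Nullary using (yes; no; Dec)
open import Relation.Binary.PropositionalEquality
open import Function using (_∘′_)

σ σ⁻¹ : ∀ {m} → Fin m → Letter (suc m)
σ i = true , i
σ⁻¹ i = false , i

inject₁≢suc : ∀ {m} (i : Fin m) → inject₁ i ≢ suc i
inject₁≢suc zero    ()
inject₁≢suc (suc i) p = inject₁≢suc i (suc-injective p)

module _ (Q : Quandle) where
  open Quandle Q
  open Action Q

  ▷◁-cancel : ∀ a y → (a ▷ y) ◁ y ≡ a
  ▷◁-cancel a y = proj₁ (bij y) (proj₂ (proj₂ (bij y) (a ▷ y)) refl)

  actLetter-cong : ∀ {n} (l : Letter n) {t t′} → t ≗ t′ → actLetter l t ≗ actLetter l t′
  actLetter-cong {suc m} (true , i) e k with k ≟ inject₁ i | k ≟ suc i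
  ... | yes _ | _     = e (suc i)
  ... | no _  | yes _ = cong₂ _▷_ (e (inject₁ i)) (e (suc i))
  ... | no _  | no _  = e k
  actLetter-cong {suc m} (false , i) e k with k ≟ inject₁ i | k ≟ suc i
  ... | yes _ | _     = cong₂ _◁_ (e (suc i)) (e (inject₁ i))
  ... | no _  | yes _ = e (inject₁ i)
  ... | no _  | no _  = e k

  act-cong : ∀ {n} (w : BraidWord n) {t t′} → t ≗ t′ → act w t ≗ act w t′
  act-cong []      e = e
  act-cong (l ∷ w) e = act-cong w (actLetter-cong l e)

  act-++ : ∀ {n} (u v : BraidWord n) t → act (u ++ v) t ≡ act v (act u t)
  act-++ []      v t = refl
  act-++ (l ∷ u) v t = act-++ u v (actLetter l t)

  σ-act-inject₁ : ∀ {m} (i : Fin m) t → actLetter (σ i) t (inject₁ i) ≡ t (suc i)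
  σ-act-inject₁ i t with inject₁ i ≟ inject₁ i
  ... | yes _ = refl
  ... | no ne = ⊥-elim (ne refl)

  σ-act-suc : ∀ {m} (i : Fin m) t → actLetter (σ i) t (suc i) ≡ t (inject₁ i) ▷ t (suc i)
  σ-act-suc i t with suc i ≟ inject₁ i | suc i ≟ suc i
  ... | yes p | _     = ⊥-elim (inject₁≢suc i (sym p))
  ... | no _  | yes _ = refl
  ... | no _  | no ne = ⊥-elim (ne refl)

  σ-act-other : ∀ {m} (i : Fin m) t {k} → k ≢ inject₁ i → k ≢ suc i → actLetter (σ i) t k ≡ t k
  σ-act-other i t {k} k≢i k≢1+i with k ≟ inject₁ i | k ≟ suc i
  ... | yes p | _     = ⊥-elim (k≢i p)
  ... | no _  | yes p = ⊥-elim (k≢1+i p)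
  ... | no _  | no _  = refl

  σ⁻¹-act-σ : ∀ {m} (i : Fin m) t → actLetter (σ⁻¹ i) (actLetter (σ i) t) ≗ t
  σ⁻¹-act-σ i t k with k ≟ inject₁ i | k ≟ suc i
  ... | yes refl | _        = trans (cong₂ _◁_ (σ-act-suc i t) (σ-act-inject₁ i t)) (▷◁-cancel _ _)
  ... | no _     | yes refl = σ-act-inject₁ i t
  ... | no k≢i   | no k≢1+i = σ-act-other i t k≢i k≢1+i

  σ-fixes-equal-neighbours : ∀ {m} (i : Fin m) t → t (inject₁ i) ≡ t (suc i) → actLetter (σ i) t ≗ t
  σ-fixes-equal-neighbours i t eq k with k ≟ inject₁ i | k ≟ suc i
  ... | yes refl | _        = sym eq
  ... | no _     | yes refl = trans (cong (_▷ t (suc i)) eq) (idem _)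
  ... | no _     | no _     = refl

  conjugate-fixes : ∀ {m} (i : Fin m) w t → act w (actLetter (σ i) t) ≗ actLetter (σ i) t →
                    act (σ i ∷ w ++ σ⁻¹ i ∷ []) t ≗ t
  conjugate-fixes i w t fixes k = begin
    act (w ++ σ⁻¹ i ∷ []) (actLetter (σ i) t) k        ≡⟨ cong (λ u → u k) (act-++ w _ _) ⟩
    actLetter (σ⁻¹ i) (act w (actLetter (σ i) t)) k   ≡⟨ actLetter-cong (σ⁻¹ i) fixes k ⟩
    actLetter (σ⁻¹ i) (actLetter (σ i) t) k           ≡⟨ σ⁻¹-act-σ i t k ⟩
    t k                                               ∎
    where open ≡-Reasoning

swap-left : ∀ {n} (a b : Fin n) → swap a b a ≡ b
swap-left a b with a ≟ a
... | yes _ = refl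
... | no ne = ⊥-elim (ne refl)

swap-right : ∀ {n} (a b : Fin n) → swap a b b ≡ a
swap-right a b with b ≟ a | b ≟ b
... | yes p | _     = p
... | no _  | yes _ = refl
... | no _  | no ne = ⊥-elim (ne refl)

swap-other : ∀ {n} {a b k : Fin n} → k ≢ a → k ≢ b → swap a b k ≡ k
swap-other {a = a} {b} {k} k≢a k≢b with k ≟ a | k ≟ b
... | yes p | _     = ⊥-elim (k≢a p)
... | no _  | yes p = ⊥-elim (k≢b p)
... | no _  | no _  = refl

swap-conjugate : ∀ {n} {a c d : Fin n} → a ≢ c → a ≢ d → c ≢ d →
                 swap c d ∘′ swap a c ∘′ swap c d ≗ swap a d
swap-conjugate {a = a} {c} {d} a≢c a≢d c≢d k = by-cases (k ≟ a) (k ≟ c) (k ≟ d)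
  where
  by-cases : Dec (k ≡ a) → Dec (k ≡ c) → Dec (k ≡ d) → swap c d (swap a c (swap c d k)) ≡ swap a d k
  by-cases (yes refl) _ _ =
    trans (cong (swap c d ∘′ swap k c) (swap-other a≢c a≢d))
          (trans (cong (swap c d) (swap-left k c)) (trans (swap-left c d) (sym (swap-left k d))))
  by-cases (no _) (yes refl) _ =
    trans (cong (swap k d ∘′ swap a k) (swap-left k d))
          (trans (cong (swap k d) (swap-other (≢-sym a≢d) (≢-sym c≢d)))
                 (trans (swap-right k d) (sym (swap-other (≢-sym a≢c) c≢d))))
  by-cases (no _) (no _) (yes refl) =
    trans (cong (swap c k ∘′ swap a c) (swap-right c k))
          (trans (cong (swap c k) (swap-right a c))
                 (trans (swap-other a≢c a≢d) (sym (swap-right a k))))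
  by-cases (no k≢a) (no k≢c) (no k≢d) =
    trans (cong (swap c d ∘′ swap a c) (swap-other k≢c k≢d))
          (trans (cong (swap c d) (swap-other k≢a k≢c))
                 (trans (swap-other k≢c k≢d) (sym (swap-other k≢a k≢d))))

perm-++ : ∀ {n} (u v : BraidWord n) → perm (u ++ v) ≗ perm v ∘′ perm u
perm-++ []      v k = refl
perm-++ (l ∷ u) v k = perm-++ u v (swap (lpos l) (rpos l) k)

module _ (Q : Quandle) where
  open Quandle Q
  open Action Q

  transposition-in-stabiliser :
    ∀ {m} d (s : Tuple Carrier (suc m)) (α : Fin (suc m)) (i : Fin m) →
    toℕ i ≡ d + toℕ α → s α ≡ s (suc i) →
    Σ (BraidWord (suc m)) λ w → act w s ≗ s × perm w ≗ swap α (suc i)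
  transposition-in-stabiliser zero s α i gap eq
    with toℕ-injective {i = α} {j = inject₁ i} (sym (trans (toℕ-inject₁ i) gap))
  ... | refl = σ i ∷ [] , σ-fixes-equal-neighbours Q i s eq , λ _ → refl
  transposition-in-stabiliser (suc d) s α zero () eq
  transposition-in-stabiliser (suc d) s α (suc j) gap eq =
    σ i ∷ w ++ σ⁻¹ i ∷ [] , conjugate-fixes Q i w s w-fixes , permutes
    where
    i = suc j
    t = actLetter (σ i) s
    α≢i : α ≢ inject₁ i
    α≢i p = m≢1+n+m (toℕ α) (trans (cong toℕ p) (trans (toℕ-inject₁ i) gap))
    α≢1+i : α ≢ suc i
    α≢1+i p = m≢1+n+m (toℕ α) (trans (cong toℕ p) (cong suc gap))
    tα≡t[i] : t α ≡ t (inject₁ i)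
    tα≡t[i] = trans (σ-act-other Q i s α≢i α≢1+i) (trans eq (sym (σ-act-inject₁ Q i s)))
    inner = transposition-in-stabiliser d t α (inject₁ j)
              (trans (toℕ-inject₁ j) (ℕ.suc-injective gap)) tα≡t[i]
    w = proj₁ inner
    w-fixes = proj₁ (proj₂ inner)
    permutes : perm (σ i ∷ w ++ σ⁻¹ i ∷ []) ≗ swap α (suc i)
    permutes k = trans (perm-++ w _ _)
      (trans (cong (swap (inject₁ i) (suc i)) (proj₂ (proj₂ inner) _))
             (swap-conjugate α≢i α≢1+i (inject₁≢suc i) k))

mainTheorem15 : (Q : Quandle) → IsFinite (Quandle.Carrier Q) →
    (n : ℕ) → 1 ≤ n → (s : Tuple (Quandle.Carrier Q) n) →
    (α β : Fin n) → α < β → s α ≡ s β →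
    Σ (BraidWord n) λ w →
      (∀ k → Action.act Q w s k ≡ s k) × (∀ k → perm w k ≡ swap α β k)
mainTheorem15 Q _ (suc m) _ s α zero    ()  _
mainTheorem15 Q _ (suc m) _ s α (suc i) α<β eq =
  transposition-in-stabiliser Q (toℕ i ∸ toℕ α) s α i (sym (m∸n+n≡m (s≤s⁻¹ α<β))) eq
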